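{- For $k\in\mathbb{N}$ and $(p,\boldsymbol{\ell},\mathbf{r})\in\mathcal{T}_k$, \[ f_{(p,\boldsymbol{\ell},\mathbf{r})}(n)=\sum_{n_1+\cdots+n_p+m=n+p}\binom{m}{p}f_0(m)\prod_{i=1}^p (f_{\ell_i}*'f_{r_i})(n_i), \] where the sum runs over all $n_1,\dots,n_p,m\in\mathbb{N}$ with $n_1+\cdots+n_p+m=n+p$.
   Context: An arithmetic formula for a positive integer $n$ is a full binary tree whose nodes carry positive integer values, such that: the root has value $n$; every leaf has value $1$; every non-leaf node is labelled $+$ (additive) or $\times$ (multiplicative); an additive node has value $a+b$ and a multiplicative node value $ab$, where $a,b$ are the values of its two children (order of children matters); both children of every multiplicative node have value at least $2$. $f_k(n)$ is the number of arithmetic formulas for $n$ with exactly $k$ multiplicative nodes. The proper Dirichlet convolution is $(g*'h)(n):=\sum_{d\mid n,\,1<d<n}g(d)h(n/d)$. A $k$-trace ($k\ge1$) is a triple $(p,\boldsymbol{\ell},\mathbf{r})$ with $p\in\mathbb{N}$, $\boldsymbol{\ell},\mathbf{r}\in\mathbb{N}_0^p$, $\sum_i(\ell_i+r_i)+p=k$; $\mathcal{T}_k$ is the set of $k$-traces. A multiplicative node is primitive if it has no multiplicative ancestor. The trace of an arithmetic formula $A$ with $k\ge1$ multiplicative nodes is $(p,\boldsymbol{\ell},\mathbf{r})$, where $N_1,\dots,N_p$ are the primitive multiplicative nodes of $A$ ordered from left to right, and $\ell_i$ (resp. $r_i$) is the number of multiplicative nodes in the left (resp. right) subtree of $N_i$.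 $f_{(p,\boldsymbol{\ell},\mathbf{r})}(n)$ is the number of arithmetic formulas for $n$ with trace $(p,\boldsymbol{\ell},\mathbf{r})$. By convention $\binom{a}{b}=0$ if $a<b$. -}

module Defs where

open import Data.Nat using (ℕ; zero; suc; _+_; _*_; _∸_; _≤_)
open import Data.Nat.Divisibility using (_∣_; _∣?_; divides)
open import Data.Nat.Combinatorics using (_C_)
open import Data.Product using (Σ; _×_; _,_)
open import Data.List as List using (List; []; _∷_; _++_; upTo)
open import Data.Nat.ListAction using (sum)
open import Data.Vec as Vec using (Vec; []; _∷_)
open import Relation.Nullary using (yes; no)
open import Data.Unit using (⊤)
open import Relation.Binary.PropositionalEquality using (_≡_)

-- Shape of an arithmetic formula: a full binary tree whose internal nodes
-- are labelled + (add) or × (mul); children are ordered.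
-- The node values are determined by the shape (leaves have value 1).
data Tree : Set where
  leaf : Tree
  add  : Tree → Tree → Tree
  mul  : Tree → Tree → Tree

val : Tree → ℕ
val leaf      = 1
val (add a b) = val a + val b
val (mul a b) = val a * val b

Valid : Tree → Set
Valid leaf      = ⊤
Valid (add a b) = Valid a × Valid b
Valid (mul a b) = Valid a × Valid b × 2 ≤ val a × 2 ≤ val b

mulCount : Tree → ℕ
mulCount leaf      = 0
mulCount (add a b) = mulCount a + mulCount b
mulCount (mul a b) = suc (mulCount a + mulCount b)

Formulas : ℕ → ℕ → Set
Formulas k n = Σ Tree (λ t → Valid t × val t ≡ n × mulCount t ≡ k)

-- primitive multiplicative nodes (no multiplicative ancestor), left to right,
-- recorded as the pair (left subtree, right subtree)
prims : Tree → List (Tree × Tree)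
prims leaf      = []
prims (add a b) = prims a ++ prims b
prims (mul a b) = (a , b) ∷ []

traceList : Tree → List (ℕ × ℕ)
traceList t = List.map (λ { (a , b) → mulCount a , mulCount b }) (prims t)

HasTrace : Tree → (p : ℕ) → Vec ℕ p → Vec ℕ p → Set
HasTrace t p ℓ r = traceList t ≡ Vec.toList (Vec.zip ℓ r)

FormulasTrace : (p : ℕ) → Vec ℕ p → Vec ℕ p → ℕ → Set
FormulasTrace p ℓ r n = Σ Tree (λ t → Valid t × val t ≡ n × HasTrace t p ℓ r)

-- [a .. b-1]
range : ℕ → ℕ → List ℕ
range a b = List.map (a +_) (upTo (b ∸ a))

-- proper Dirichlet convolution: sum over d ∣ n with 1 < d < n of g d * h (n/d)
conv' : (ℕ → ℕ) → (ℕ → ℕ) → ℕ → ℕ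
conv' g h n = sum (List.map term (range 2 n))
  where
  term : ℕ → ℕ
  term d with d ∣? n
  ... | yes (divides q _) = g d * h q
  ... | no _              = 0

-- sumComp p N G = Σ G (n₁ ∷ … ∷ nₚ) m over all n₁,…,nₚ,m ≥ 1 with
-- n₁ + … + nₚ + m = N
sumComp : (p : ℕ) → ℕ → (Vec ℕ p → ℕ → ℕ) → ℕ
sumComp zero    zero    G = 0
sumComp zero    (suc N) G = G [] (suc N)
sumComp (suc p) N       G =
  sum (List.map (λ a → sumComp p (N ∸ a) (λ v m → G (a ∷ v) m)) (range 1 (suc N)))

prodV : ∀ {p} → Vec ℕ p → ℕ
prodV = Vec.foldr _ _*_ 1

sumV : ∀ {p} → Vec ℕ p → ℕ
sumV = Vec.foldr _ _+_ 0

-- right-hand side of Lemma 4.4, for a counting function F k n = f_k(n)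
rhs : (F : ℕ → ℕ → ℕ) (p : ℕ) → Vec ℕ p → Vec ℕ p → ℕ → ℕ
rhs F p ℓ r n =
  sumComp p (n + p) (λ ns m →
    (m C p) * F 0 m *
    prodV (Vec.zipWith (λ { (li , ri) ni → conv' (F li) (F ri) ni }) (Vec.zip ℓ r) ns))

module Submission where

-- Both sides of the identity are read as finite sets and matched by explicit
-- bijections.  On the formula side, a formula t is determined by three pieces
-- of data (skeleton-↔): its additive skeleton t₀ (t with every primitive
-- product replaced by a leaf), the marking of those leaves of t₀ that were
-- products, and the list of primitive products, read from left to right.  The
-- value satisfies val t + p = val t₀ + Σᵢ val(Nᵢ), validity of t is validity
-- of the Nᵢ, and the trace of t is the list of factor counts of the Nᵢ.
-- On the counting side, the composition sum is a Σ-type over (n₁,…,nₚ,m)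
-- (compositions-↔), the binomial coefficient counts markings (binomial-↔),
-- f₀(m) counts skeletons, and f_ℓ *' f_r counts valid products whose factors
-- have ℓ and r multiplicative nodes (conv'-↔).  After forgetting the values
-- nᵢ and m, which are determined by the trees, the two sides coincide.

open import Defs
open import Data.Nat using (ℕ; zero; suc; _+_; _*_; _∸_; _≤_; _<_; _≟_; z≤n; s≤s)
open import Data.Nat.Properties
open import Algebra.Properties.CommutativeSemigroup +-commutativeSemigroup using (interchange)
open import Data.Nat.Combinatorics using (_C_; nCk+nC[k+1]≡[n+1]C[k+1])
open import Data.Nat.Divisibility using (_∣?_; divides)
open import Data.Nat.ListAction using (sum)
open import Data.Nat.ListAction.Properties using (sum-++)
open import Data.Bool using (Bool; true; false)
open import Data.Fin using (Fin; toℕ; fromℕ<)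
import Data.Fin as Fin
open import Data.Fin.Properties using (1↔⊤; +↔⊎; *↔×; toℕ-injective; toℕ<n; toℕ-fromℕ<)
open import Data.Vec as Vec using (Vec; []; _∷_; zipWith; splitAt)
import Data.Vec.Properties as VecProps
open import Data.Vec.Relation.Unary.All as VecAll using ([]; _∷_)
open import Data.List as List using (List; []; _∷_; _++_; length; applyUpTo; upTo)
open import Data.List.Properties using (++-assoc; ++-identityʳ; length-++; ∷-injective; map-cong; map-∘)
import Data.List.Properties as ListProps
open import Data.List.Relation.Unary.All as All using (All; []; _∷_)
open import Data.List.Relation.Unary.All.Properties using (++⁺; ++⁻)
open import Data.Product using (Σ; _×_; _,_; proj₁; proj₂)
import Data.Product.Properties as ProductProps
open import Data.Product.Function.NonDependent.Propositional using (_×-↔_)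
import Data.Product.Function.Dependent.Propositional as Dependent
open import Data.Sum using (_⊎_; inj₁; inj₂)
open import Data.Sum.Function.Propositional using (_⊎-↔_)
open import Data.Empty using (⊥-elim)
open import Data.Unit using (⊤; tt)
open import Function using (_∘_; id)
open import Function.Bundles using (_↔_; Inverse; mk↔ₛ′)
open import Function.Properties.Inverse using (↔-refl; ↔-sym; ↔-trans)
open import Function.Related.Propositional using (bijection)
open import Relation.Binary.PropositionalEquality
open import Relation.Nullary using (¬_; Irrelevant; yes; no)
open import Axiom.UniquenessOfIdentityProofs using (module Decidable⇒UIP)

private
  variable
    A B D : Set
    m p : ℕ

infixr 2 _⨾_
_⨾_ : A ↔ B → B ↔ D → A ↔ D
_⨾_ = ↔-trans

Σ-cong : {I : Set} {P Q : I → Set} → (∀ i → P i ↔ Q i) → Σ I P ↔ Σ I Q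
Σ-cong e = Dependent.congˡ {k = bijection} (λ {i} → e i)

prop-↔ : Irrelevant A → Irrelevant B → (A → B) → (B → A) → A ↔ B
prop-↔ irrA irrB f g = mk↔ₛ′ f g (λ _ → irrB _ _) (λ _ → irrA _ _)

empty-↔ : ¬ A → ¬ B → A ↔ B
empty-↔ ¬a ¬b = mk↔ₛ′ (⊥-elim ∘ ¬a) (⊥-elim ∘ ¬b) (⊥-elim ∘ ¬b) (⊥-elim ∘ ¬a)

⊎-emptyˡ : ¬ A → (A ⊎ B) ↔ B
⊎-emptyˡ ¬a = mk↔ₛ′ (λ { (inj₁ a) → ⊥-elim (¬a a) ; (inj₂ b) → b }) inj₂
  (λ _ → refl) (λ { (inj₁ a) → ⊥-elim (¬a a) ; (inj₂ _) → refl })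

subst-↔ : {I : Set} (P : I → Set) {i j : I} → i ≡ j → P i ↔ P j
subst-↔ P refl = ↔-refl

contract : {R P : ℕ → Set} {x₀ : ℕ} → (∀ {x} → Irrelevant (R x)) → R x₀ → (∀ {x} → R x → x ≡ x₀) →
           Σ ℕ (λ x → R x × P x) ↔ P x₀
contract {R} {P} {x₀} irr r₀ unique = mk↔ₛ′ to from to∘from from∘to
  where
  to : Σ ℕ (λ x → R x × P x) → P x₀
  to (x , r , y) = subst P (unique r) y
  from : P x₀ → Σ ℕ (λ x → R x × P x)
  from y = x₀ , r₀ , y
  to∘from : ∀ y → to (from y) ≡ y
  to∘from y = cong (λ e → subst P e y) (≡-irrelevant (unique r₀) refl)
  back : ∀ x (e : x ≡ x₀) (r : R x) (y : P x) → (x₀ , r₀ , subst P e y) ≡ (x , r , y)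
  back _ refl r y = cong (λ r′ → x₀ , r′ , y) (irr r₀ r)
  from∘to : ∀ w → from (to w) ≡ w
  from∘to (x , r , y) = back x (unique r) r y

count : Vec Bool m → ℕ
count []           = 0
count (true ∷ bs)  = suc (count bs)
count (false ∷ bs) = count bs

count≤length : (bs : Vec Bool m) → count bs ≤ m
count≤length []           = z≤n
count≤length (true ∷ bs)  = s≤s (count≤length bs)
count≤length (false ∷ bs) = m≤n⇒m≤1+n (count≤length bs)

count-++ : ∀ {n} (xs : Vec Bool m) (ys : Vec Bool n) → count (xs Vec.++ ys) ≡ count xs + count ys
count-++ []           ys = refl
count-++ (true ∷ xs)  ys = cong suc (count-++ xs ys)
count-++ (false ∷ xs) ys = count-++ xs ys

Marks : ℕ → ℕ → Set
Marks m p = Σ (Vec Bool m) λ bs → count bs ≡ p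

-- Pascal's rule on markings: the first position is marked or not.
Marks-suc : ∀ m p → Marks (suc m) p ↔ (Σ (Vec Bool m) (λ bs → suc (count bs) ≡ p) ⊎ Marks m p)
Marks-suc m p = mk↔ₛ′
  (λ { (true ∷ bs , c) → inj₁ (bs , c) ; (false ∷ bs , c) → inj₂ (bs , c) })
  (λ { (inj₁ (bs , c)) → true ∷ bs , c ; (inj₂ (bs , c)) → false ∷ bs , c })
  (λ { (inj₁ _) → refl ; (inj₂ _) → refl })
  (λ { (true ∷ _ , _) → refl ; (false ∷ _ , _) → refl })

binomial-↔ : ∀ m p → Fin (m C p) ↔ Marks m p
binomial-↔ zero zero =
  1↔⊤ ⨾ mk↔ₛ′ (λ _ → [] , refl) (λ _ → tt) (λ { ([] , refl) → refl }) (λ _ → refl)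
binomial-↔ zero (suc p) = empty-↔ (λ ()) (λ { ([] , ()) })
binomial-↔ (suc m) zero =
  binomial-↔ m zero ⨾ ↔-sym (⊎-emptyˡ (λ { (_ , ()) })) ⨾ ↔-sym (Marks-suc m zero)
binomial-↔ (suc m) (suc p) =
  subst-↔ Fin (sym (nCk+nC[k+1]≡[n+1]C[k+1] m p)) ⨾ +↔⊎ ⨾
  ((binomial-↔ m p ⨾ Σ-cong λ _ → prop-↔ ≡-irrelevant ≡-irrelevant (cong suc) suc-injective)
    ⊎-↔ binomial-↔ m (suc p)) ⨾
  ↔-sym (Marks-suc m (suc p))

InRange : ℕ → ℕ → ℕ → Set
InRange a k x = Σ (Fin k) λ i → a + toℕ i ≡ x

InRange-irrelevant : ∀ {a k x} → Irrelevant (InRange a k x)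
InRange-irrelevant {a} (i , e) (j , e′)
  with toℕ-injective {i = i} {j} (+-cancelˡ-≡ a (toℕ i) (toℕ j) (trans e (sym e′)))
... | refl = cong (i ,_) (≡-irrelevant e e′)

InRange⇒bounds : ∀ {a k x} → InRange a k x → a ≤ x × x < a + k
InRange⇒bounds {a} (i , refl) = m≤m+n a (toℕ i) , +-monoʳ-< a (toℕ<n i)

bounds⇒InRange : ∀ {a k x} → a ≤ x → x < a + k → InRange a k x
bounds⇒InRange {a} {k} {x} a≤x x<a+k =
  fromℕ< offset<k , trans (cong (a +_) (toℕ-fromℕ< offset<k)) (m+[n∸m]≡n a≤x)
  where
  offset<k : x ∸ a < k
  offset<k = +-cancelˡ-< a (x ∸ a) k (subst (_< a + k) (sym (m+[n∸m]≡n a≤x)) x<a+k)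

Σ-Fin-suc : ∀ {k} {P : Fin (suc k) → Set} → (P Fin.zero ⊎ Σ (Fin k) (P ∘ Fin.suc)) ↔ Σ (Fin (suc k)) P
Σ-Fin-suc = mk↔ₛ′
  (λ { (inj₁ y) → Fin.zero , y ; (inj₂ (i , y)) → Fin.suc i , y })
  (λ { (Fin.zero , y) → inj₁ y ; (Fin.suc i , y) → inj₂ (i , y) })
  (λ { (Fin.zero , _) → refl ; (Fin.suc _ , _) → refl })
  (λ { (inj₁ _) → refl ; (inj₂ _) → refl })

sum-↔ : (f g : ℕ → ℕ) (k : ℕ) →
  Fin (sum (List.map f (applyUpTo g k))) ↔ Σ (Fin k) (λ i → Fin (f (g (toℕ i))))
sum-↔ f g zero    = empty-↔ (λ ()) (λ { (() , _) })
sum-↔ f g (suc k) = +↔⊎ ⨾ (↔-refl ⊎-↔ sum-↔ f (g ∘ suc) k) ⨾ Σ-Fin-suc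

range-↔ : (f : ℕ → ℕ) (a b : ℕ) →
  Fin (sum (List.map f (range a b))) ↔ Σ ℕ (λ x → InRange a (b ∸ a) x × Fin (f x))
range-↔ f a b =
  subst-↔ Fin (cong sum (sym (map-∘ (upTo (b ∸ a))))) ⨾ sum-↔ (f ∘ (a +_)) id (b ∸ a) ⨾ by-value
  where
  by-value : Σ (Fin (b ∸ a)) (λ i → Fin (f (a + toℕ i))) ↔ Σ ℕ (λ x → InRange a (b ∸ a) x × Fin (f x))
  by-value = mk↔ₛ′
    (λ (i , y) → a + toℕ i , (i , refl) , y) (λ (x , (i , e) , y) → i , subst (Fin ∘ f) (sym e) y)
    (λ { (x , (i , refl) , y) → refl }) (λ _ → refl)

Compositions : (p : ℕ) → ℕ → (Vec ℕ p → ℕ → ℕ) → Set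
Compositions p N G = Σ (Vec ℕ p) λ v → Σ ℕ λ m → sumV v + m ≡ N × Fin (G v m)

-- G counts nothing unless all parts are positive; this is what makes the ranges
-- [1, N] of sumComp exhaust the compositions.
PositiveSupport : (Vec ℕ p → ℕ → ℕ) → Set
PositiveSupport G = ∀ v m → Fin (G v m) → VecAll.All (1 ≤_) v × 1 ≤ m

compositions-cons : ∀ p N (G : Vec ℕ (suc p) → ℕ → ℕ) → PositiveSupport G →
  Σ ℕ (λ a → InRange 1 N a × Compositions p (N ∸ a) (λ v m → G (a ∷ v) m)) ↔ Compositions (suc p) N G
compositions-cons p N G positive = mk↔ₛ′ to from
  (λ { (a ∷ v , m , e , y) → cong (λ e′ → a ∷ v , m , e′ , y) (≡-irrelevant _ _) })
  (λ { (a , a∈ , v , m , e , y) →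
         cong₂ (λ a∈′ e′ → a , a∈′ , v , m , e′ , y) (InRange-irrelevant _ _) (≡-irrelevant _ _) })
  where
  to : Σ ℕ (λ a → InRange 1 N a × Compositions p (N ∸ a) (λ v m → G (a ∷ v) m)) → Compositions (suc p) N G
  to (a , a∈ , v , m , e , y) = a ∷ v , m , total , y
    where
    total : a + sumV v + m ≡ N
    total = trans (+-assoc a (sumV v) m) (trans (cong (a +_) e) (m+[n∸m]≡n (≤-pred (proj₂ (InRange⇒bounds a∈)))))
  from : Compositions (suc p) N G → Σ ℕ (λ a → InRange 1 N a × Compositions p (N ∸ a) (λ v m → G (a ∷ v) m))
  from (a ∷ v , m , e , y) = a , bounds⇒InRange 1≤a (s≤s a≤N) , v , m , rest , y
    where
    1≤a : 1 ≤ a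
    1≤a with positive (a ∷ v) m y
    ... | (1≤a ∷ _) , _ = 1≤a
    total : a + (sumV v + m) ≡ N
    total = trans (sym (+-assoc a (sumV v) m)) e
    a≤N : a ≤ N
    a≤N = subst (a ≤_) total (m≤m+n a (sumV v + m))
    rest : sumV v + m ≡ N ∸ a
    rest = sym (trans (cong (_∸ a) (sym total)) (m+n∸m≡n a (sumV v + m)))

compositions-↔ : ∀ p N (G : Vec ℕ p → ℕ → ℕ) → PositiveSupport G →
  Fin (sumComp p N G) ↔ Compositions p N G
compositions-↔ zero zero G positive = empty-↔ (λ ()) (λ { ([] , _ , refl , y) → 1≰0 (proj₂ (positive [] 0 y)) })
  where
  1≰0 : ¬ (1 ≤ 0)
  1≰0 ()
compositions-↔ zero (suc N) G positive = mk↔ₛ′ (λ y → [] , suc N , refl , y)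
  (λ { ([] , m , e , y) → subst (Fin ∘ G []) e y }) (λ { ([] , _ , refl , _) → refl }) (λ _ → refl)
compositions-↔ (suc p) N G positive =
  range-↔ (λ a → sumComp p (N ∸ a) (λ v m → G (a ∷ v) m)) 1 (suc N) ⨾
  Σ-cong (λ a → ↔-refl ×-↔ compositions-↔ p (N ∸ a) (λ v m → G (a ∷ v) m) (positive-tail a)) ⨾
  compositions-cons p N G positive
  where
  positive-tail : ∀ a → PositiveSupport (λ v m → G (a ∷ v) m)
  positive-tail a v m y with positive (a ∷ v) m y
  ... | (_ ∷ pos) , 1≤m = pos , 1≤m

Valid-irrelevant : ∀ t → Irrelevant (Valid t)
Valid-irrelevant leaf      tt         tt           = refl
Valid-irrelevant (add a b) (va , vb)  (va′ , vb′)  =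
  cong₂ _,_ (Valid-irrelevant a va va′) (Valid-irrelevant b vb vb′)
Valid-irrelevant (mul a b) (va , vb , la , lb) (va′ , vb′ , la′ , lb′) =
  cong₂ _,_ (Valid-irrelevant a va va′)
    (cong₂ _,_ (Valid-irrelevant b vb vb′) (cong₂ _,_ (≤-irrelevant la la′) (≤-irrelevant lb lb′)))

Formulas-≡ : ∀ {k n} {x y : Formulas k n} → proj₁ x ≡ proj₁ y → x ≡ y
Formulas-≡ {x = t , v , e , c} {.t , v′ , e′ , c′} refl
  rewrite Valid-irrelevant t v v′ | ≡-irrelevant e e′ | ≡-irrelevant c c′ = refl

val-positive : ∀ t → 1 ≤ val t
val-positive leaf      = s≤s z≤n
val-positive (add a b) = ≤-trans (val-positive a) (m≤m+n (val a) (val b))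
val-positive (mul a b) = *-mono-≤ (val-positive a) (val-positive b)

mulFree⇒Valid : ∀ t → mulCount t ≡ 0 → Valid t
mulFree⇒Valid leaf      _  = tt
mulFree⇒Valid (add a b) mf =
  mulFree⇒Valid a (m+n≡0⇒m≡0 (mulCount a) mf) , mulFree⇒Valid b (m+n≡0⇒n≡0 (mulCount a) mf)

-- A block (a , b) stands for the product node a × b.
Block : Set
Block = Tree × Tree

blockVal : Block → ℕ
blockVal (a , b) = val a * val b

ValidBlock : Block → Set
ValidBlock (a , b) = Valid (mul a b)

factorCounts : Block → ℕ × ℕ
factorCounts (a , b) = mulCount a , mulCount b

Fits : ℕ × ℕ → Block → Set
Fits u β = ValidBlock β × factorCounts β ≡ u

counts-≡-irrelevant : {u v : ℕ × ℕ} → Irrelevant (u ≡ v)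
counts-≡-irrelevant = Decidable⇒UIP.≡-irrelevant (ProductProps.≡-dec _≟_ _≟_)

traces-≡-irrelevant : {xs ys : List (ℕ × ℕ)} → Irrelevant (xs ≡ ys)
traces-≡-irrelevant = Decidable⇒UIP.≡-irrelevant (ListProps.≡-dec (ProductProps.≡-dec _≟_ _≟_))

Fits-irrelevant : ∀ u β → Irrelevant (Fits u β)
Fits-irrelevant u (a , b) (v , c) (v′ , c′) =
  cong₂ _,_ (Valid-irrelevant (mul a b) v v′) (counts-≡-irrelevant c c′)

Products : ℕ × ℕ → ℕ → Set
Products u x = Σ Block λ β → Fits u β × blockVal β ≡ x

Products-≡ : ∀ {u x} {y z : Products u x} → proj₁ y ≡ proj₁ z → y ≡ z
Products-≡ {u} {y = β , f , e} {.β , f′ , e′} refl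
  rewrite Fits-irrelevant u β f f′ | ≡-irrelevant e e′ = refl

-- Defs defines conv' through a local summand; unification gives it a name.
conv'-as-sum : (g h : ℕ → ℕ) (n : ℕ) → Σ (ℕ → ℕ) λ term → conv' g h n ≡ sum (List.map term (range 2 n))
conv'-as-sum g h n = _ , refl

divisorTerm : (g h : ℕ → ℕ) (n d : ℕ) → ℕ
divisorTerm g h n = proj₁ (conv'-as-sum g h n)

divisorTerm-↔ : ∀ (g h : ℕ → ℕ) n d →
  Fin (divisorTerm g h n (suc d)) ↔ Σ ℕ (λ q → n ≡ q * suc d × (Fin (g (suc d)) × Fin (h q)))
divisorTerm-↔ g h n d with suc d ∣? n
... | no ∤n                = empty-↔ (λ ()) (λ (q , e , _) → ∤n (divides q e))
... | yes (divides q n≡qd) =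
  *↔× ⨾ ↔-sym (contract ≡-irrelevant n≡qd unique)
  where
  unique : ∀ {q′} → n ≡ q′ * suc d → q′ ≡ q
  unique {q′} n≡q′d = *-cancelʳ-≡ q′ q (suc d) (trans (sym n≡q′d) n≡qd)

cofactor≥2 : ∀ d q n → 2 ≤ d → d < 2 + (n ∸ 2) → n ≡ q * d → 2 ≤ q
cofactor≥2 d zero          .0 2≤d d<n refl = ⊥-elim (<⇒≱ d<n 2≤d)
cofactor≥2 d (suc zero)    n  2≤d d<n e    = ⊥-elim (<-irrefl refl (subst (d <_) n≡d d<n))
  where
  n≡d : 2 + (n ∸ 2) ≡ d
  n≡d = trans (cong (λ z → 2 + (z ∸ 2)) (trans e (+-identityʳ d))) (m+[n∸m]≡n 2≤d)
cofactor≥2 d (suc (suc q)) n  _   _   _    = s≤s (s≤s z≤n)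

factor<product : ∀ x y → 2 ≤ x → 2 ≤ y → x < 2 + (x * y ∸ 2)
factor<product x y 2≤x 2≤y = subst (x <_) (sym (m+[n∸m]≡n 2≤xy)) x<xy
  where
  x<xy : x < x * y
  x<xy = <-≤-trans (m<m+n x (≤-trans (s≤s z≤n) 2≤x))
           (subst (_≤ x * y) (trans (*-comm x 2) (cong (x +_) (+-identityʳ x))) (*-monoʳ-≤ x 2≤y))
  2≤xy : 2 ≤ x * y
  2≤xy = ≤-trans 2≤x (<⇒≤ x<xy)

factorizations-↔ : ∀ l r n →
  Σ ℕ (λ d → InRange 2 (n ∸ 2) d × Σ ℕ (λ q → n ≡ q * d × (Formulas l d × Formulas r q))) ↔
  Products (l , r) n
factorizations-↔ l r n = mk↔ₛ′ to from (λ _ → Products-≡ refl) from∘to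
  where
  Factorizations : Set
  Factorizations = Σ ℕ (λ d → InRange 2 (n ∸ 2) d × Σ ℕ (λ q → n ≡ q * d × (Formulas l d × Formulas r q)))
  to : Factorizations → Products (l , r) n
  to (.(val a) , d∈ , .(val b) , e , (a , va , refl , ma) , (b , vb , refl , mb)) =
    (a , b) , ((va , vb , 2≤a , cofactor≥2 (val a) (val b) n 2≤a a<n e) , cong₂ _,_ ma mb) ,
    trans (*-comm (val a) (val b)) (sym e)
    where
    2≤a = proj₁ (InRange⇒bounds d∈)
    a<n = proj₂ (InRange⇒bounds d∈)
  from : Products (l , r) n → Factorizations
  from ((a , b) , ((va , vb , 2≤a , 2≤b) , c) , e) =
    val a , bounds⇒InRange 2≤a (subst (λ x → val a < 2 + (x ∸ 2)) e (factor<product (val a) (val b) 2≤a 2≤b)) ,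
    val b , trans (sym e) (*-comm (val a) (val b)) , (a , va , refl , cong proj₁ c) , (b , vb , refl , cong proj₂ c)
  from∘to : ∀ x → from (to x) ≡ x
  from∘to (.(val a) , d∈ , .(val b) , e , (a , va , refl , ma) , (b , vb , refl , mb)) =
    cong₂ (λ (d∈′ , e′) (A , B) → val a , d∈′ , val b , e′ , A , B)
      (cong₂ _,_ (InRange-irrelevant _ _) (≡-irrelevant _ _)) (cong₂ _,_ (Formulas-≡ refl) (Formulas-≡ refl))

Counts : (ℕ → ℕ → ℕ) → Set
Counts F = ∀ k n → Formulas k n ↔ Fin (F k n)

conv'-↔ : (F : ℕ → ℕ → ℕ) → Counts F → ∀ l r n → Fin (conv' (F l) (F r) n) ↔ Products (l , r) n
conv'-↔ F counts l r n =
  range-↔ (divisorTerm (F l) (F r) n) 2 n ⨾ Σ-cong (λ d → Σ-cong (summand d)) ⨾ factorizations-↔ l r n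
  where
  summand : ∀ d → InRange 2 (n ∸ 2) d →
    Fin (divisorTerm (F l) (F r) n d) ↔ Σ ℕ (λ q → n ≡ q * d × (Formulas l d × Formulas r q))
  summand zero    d∈ with () ← proj₁ (InRange⇒bounds d∈)
  summand (suc d) _  = divisorTerm-↔ (F l) (F r) n d ⨾
    Σ-cong (λ q → ↔-refl ×-↔ (↔-sym (counts l (suc d)) ×-↔ ↔-sym (counts r q)))

Tuple : {U X : Set} → (U → X → Set) → Vec U p → Vec X p → Set
Tuple P []       []       = ⊤
Tuple P (u ∷ us) (x ∷ xs) = P u x × Tuple P us xs

prodV-↔ : {U X : Set} (c : U → X → ℕ) (P : U → X → Set) → (∀ u x → Fin (c u x) ↔ P u x) →
  (us : Vec U p) (xs : Vec X p) → Fin (prodV (zipWith c us xs)) ↔ Tuple P us xs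
prodV-↔ c P c↔P []       []       = 1↔⊤
prodV-↔ c P c↔P (u ∷ us) (x ∷ xs) = *↔× ⨾ (c↔P u x ×-↔ prodV-↔ c P c↔P us xs)

sumL : List Block → ℕ
sumL X = sum (List.map blockVal X)

Fitting : Vec (ℕ × ℕ) p → List Block → Set
Fitting us X = All ValidBlock X × List.map factorCounts X ≡ Vec.toList us

Fitting-irrelevant : ∀ (us : Vec (ℕ × ℕ) p) X → Irrelevant (Fitting us X)
Fitting-irrelevant us X (v , e) (v′ , e′) =
  cong₂ _,_ (All.irrelevant (λ {β} → Valid-irrelevant (mul (proj₁ β) (proj₂ β))) v v′)
            (traces-≡-irrelevant e e′)

Fitting-length : ∀ (us : Vec (ℕ × ℕ) p) X → Fitting us X → length X ≡ p
Fitting-length {p} us X (_ , e) = begin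
  length X                          ≡⟨ ListProps.length-map factorCounts X ⟨
  length (List.map factorCounts X)  ≡⟨ cong length e ⟩
  length (Vec.toList us)            ≡⟨ VecProps.length-toList us ⟩
  p                                 ∎
  where open ≡-Reasoning

Fitting-∷ : ∀ u (us : Vec (ℕ × ℕ) p) β X → Fitting (u ∷ us) (β ∷ X) ↔ (Fits u β × Fitting us X)
Fitting-∷ u us β X = prop-↔ (Fitting-irrelevant (u ∷ us) (β ∷ X))
  (λ (f , g) (f′ , g′) → cong₂ _,_ (Fits-irrelevant u β f f′) (Fitting-irrelevant us X g g′))
  (λ { (v ∷ vs , e) → (v , proj₁ (∷-injective e)) , (vs , proj₂ (∷-injective e)) })
  (λ ((v , c) , (vs , e)) → v ∷ vs , cong₂ _∷_ c e)

tuples-to-list : (Q : ℕ → Set) (us : Vec (ℕ × ℕ) p) →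
  Σ (Vec ℕ p) (λ v → Tuple Products us v × Q (sumV v)) ↔ Σ (List Block) (λ X → Fitting us X × Q (sumL X))
tuples-to-list Q [] = mk↔ₛ′
  (λ { ([] , tt , q) → [] , ([] , refl) , q })
  (λ { ([] , _ , q) → [] , tt , q ; (_ ∷ _ , (_ , ()) , _) })
  (λ { ([] , f , q) → cong (λ f′ → [] , f′ , q) (Fitting-irrelevant [] [] _ f) ; (_ ∷ _ , (_ , ()) , _) })
  (λ { ([] , tt , q) → refl })
tuples-to-list Q (u ∷ us) =
  peel ⨾ Σ-cong (λ x → ↔-refl ×-↔ tuples-to-list (λ s → Q (x + s)) us) ⨾ absorb
  where
  peel : Σ (Vec ℕ (suc _)) (λ v → Tuple Products (u ∷ us) v × Q (sumV v)) ↔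
         Σ ℕ (λ x → Products u x × Σ (Vec ℕ _) (λ v → Tuple Products us v × Q (x + sumV v)))
  peel = mk↔ₛ′
    (λ { (x ∷ v , (π , πs) , q) → x , π , v , πs , q }) (λ (x , π , v , πs , q) → x ∷ v , (π , πs) , q)
    (λ _ → refl) (λ { (_ ∷ _ , _ , _) → refl })
  absorb : Σ ℕ (λ x → Products u x × Σ (List Block) (λ X → Fitting us X × Q (x + sumL X))) ↔
           Σ (List Block) (λ X → Fitting (u ∷ us) X × Q (sumL X))
  absorb = mk↔ₛ′
    (λ (x , (β , f , e) , X , g , q) → β ∷ X , Inverse.from (Fitting-∷ u us β X) (f , g) ,
                                       subst (λ z → Q (z + sumL X)) (sym e) q)
    (λ { (β ∷ X , fg , q) → blockVal β , (β , proj₁ (Inverse.to (Fitting-∷ u us β X) fg) , refl) ,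
                           X , proj₂ (Inverse.to (Fitting-∷ u us β X) fg) , q
       ; ([] , (_ , ()) , _) })
    (λ { (β ∷ X , fg , q) → cong (λ fg′ → β ∷ X , fg′ , q) (Fitting-irrelevant (u ∷ us) (β ∷ X) _ _)
       ; ([] , (_ , ()) , _) })
    (λ { (.(blockVal β) , (β , f , refl) , X , g , q) →
         cong₂ (λ f′ g′ → blockVal β , (β , f′ , refl) , X , g′ , q)
               (Fits-irrelevant u β _ _) (Fitting-irrelevant us X _ _) })

skeleton : Tree → Tree
skeleton leaf      = leaf
skeleton (add a b) = add (skeleton a) (skeleton b)
skeleton (mul a b) = leaf

marks : (t : Tree) → Vec Bool (val (skeleton t))
marks leaf      = false ∷ []
marks (add a b) = marks a Vec.++ marks b
marks (mul a b) = true ∷ []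

skeleton-mulFree : ∀ t → mulCount (skeleton t) ≡ 0
skeleton-mulFree leaf      = refl
skeleton-mulFree (add a b) = cong₂ _+_ (skeleton-mulFree a) (skeleton-mulFree b)
skeleton-mulFree (mul a b) = refl

marks-count : ∀ t → count (marks t) ≡ length (prims t)
marks-count leaf      = refl
marks-count (mul a b) = refl
marks-count (add a b) = begin
  count (marks a Vec.++ marks b)      ≡⟨ count-++ (marks a) (marks b) ⟩
  count (marks a) + count (marks b)   ≡⟨ cong₂ _+_ (marks-count a) (marks-count b) ⟩
  length (prims a) + length (prims b) ≡⟨ length-++ (prims a) ⟨
  length (prims a ++ prims b)         ∎
  where open ≡-Reasoning

sumL-++ : ∀ X Y → sumL (X ++ Y) ≡ sumL X + sumL Y
sumL-++ X Y = trans (cong sum (ListProps.map-++ blockVal X Y)) (sum-++ (List.map blockVal X) _)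

-- Each primitive product contributes its value and takes the place of one leaf.
val-decompose : ∀ t → val t + count (marks t) ≡ val (skeleton t) + sumL (prims t)
val-decompose leaf      = refl
val-decompose (mul a b) = trans (+-comm (val a * val b) 1) (cong suc (sym (+-identityʳ _)))
val-decompose (add a b) = begin
  (val a + val b) + count (marks a Vec.++ marks b)
    ≡⟨ cong ((val a + val b) +_) (count-++ (marks a) (marks b)) ⟩
  (val a + val b) + (count (marks a) + count (marks b))
    ≡⟨ interchange (val a) (val b) _ _ ⟩
  (val a + count (marks a)) + (val b + count (marks b))
    ≡⟨ cong₂ _+_ (val-decompose a) (val-decompose b) ⟩
  (val (skeleton a) + sumL (prims a)) + (val (skeleton b) + sumL (prims b))
    ≡⟨ interchange (val (skeleton a)) _ _ _ ⟩
  (val (skeleton a) + val (skeleton b)) + (sumL (prims a) + sumL (prims b))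
    ≡⟨ cong (val (skeleton a) + val (skeleton b) +_) (sumL-++ (prims a) (prims b)) ⟨
  (val (skeleton a) + val (skeleton b)) + sumL (prims a ++ prims b) ∎
  where open ≡-Reasoning

Valid⇒blocks : ∀ t → Valid t → All ValidBlock (prims t)
Valid⇒blocks leaf      _         = []
Valid⇒blocks (add a b) (va , vb) = ++⁺ (Valid⇒blocks a va) (Valid⇒blocks b vb)
Valid⇒blocks (mul a b) v         = v ∷ []

blocks⇒Valid : ∀ t → All ValidBlock (prims t) → Valid t
blocks⇒Valid leaf      _        = tt
blocks⇒Valid (add a b) vs       =
  blocks⇒Valid a (proj₁ (++⁻ (prims a) vs)) , blocks⇒Valid b (proj₂ (++⁻ (prims a) vs))
blocks⇒Valid (mul a b) (v ∷ []) = v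

trace-prims : ∀ t → traceList t ≡ List.map factorCounts (prims t)
trace-prims t = map-cong (λ _ → refl) (prims t)

assemble : (t₀ : Tree) → Vec Bool (val t₀) → List Block → Tree × List Block
assemble leaf      (false ∷ []) Z             = leaf , Z
assemble leaf      (true ∷ [])  []            = leaf , []
assemble leaf      (true ∷ [])  ((a , b) ∷ Z) = mul a b , Z
assemble (add t u) bs           Z             =
  let (t′ , Z₁) = assemble t (Vec.take (val t) bs) Z
      (u′ , Z₂) = assemble u (Vec.drop (val t) bs) Z₁
  in add t′ u′ , Z₂
assemble (mul t u) bs           Z             = leaf , Z

splitAt-++ : ∀ {n} (xs : Vec A m) (ys : Vec A n) → splitAt m (xs Vec.++ ys) ≡ (xs , ys , refl)
splitAt-++ []       ys = refl
splitAt-++ (x ∷ xs) ys rewrite splitAt-++ xs ys = refl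

assemble-decompose : ∀ t Y → assemble (skeleton t) (marks t) (prims t ++ Y) ≡ (t , Y)
assemble-decompose leaf      Y = refl
assemble-decompose (mul a b) Y = refl
assemble-decompose (add a b) Y
  rewrite splitAt-++ (marks a) (marks b) | ++-assoc (prims a) (prims b) Y
        | assemble-decompose a (prims b ++ Y) | assemble-decompose b Y = refl

prims-assemble : ∀ t₀ bs Z → prims (proj₁ (assemble t₀ bs Z)) ++ proj₂ (assemble t₀ bs Z) ≡ Z
prims-assemble leaf      (false ∷ []) Z       = refl
prims-assemble leaf      (true ∷ [])  []      = refl
prims-assemble leaf      (true ∷ [])  (_ ∷ Z) = refl
prims-assemble (mul t u) bs           Z       = refl
prims-assemble (add t u) bs           Z       = begin
  (prims t′ ++ prims u′) ++ Z₂ ≡⟨ ++-assoc (prims t′) (prims u′) Z₂ ⟩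
  prims t′ ++ (prims u′ ++ Z₂) ≡⟨ cong (prims t′ ++_) (prims-assemble u _ Z₁) ⟩
  prims t′ ++ Z₁               ≡⟨ prims-assemble t _ Z ⟩
  Z                            ∎
  where
  open ≡-Reasoning
  t′ = proj₁ (assemble t (Vec.take (val t) bs) Z)
  Z₁ = proj₂ (assemble t (Vec.take (val t) bs) Z)
  u′ = proj₁ (assemble u (Vec.drop (val t) bs) Z₁)
  Z₂ = proj₂ (assemble u (Vec.drop (val t) bs) Z₁)

MarkedTree : Set
MarkedTree = Σ Tree λ t → Vec Bool (val t)

skeleton-assemble : ∀ t₀ → mulCount t₀ ≡ 0 → (bs : Vec Bool (val t₀)) (Z : List Block) → count bs ≤ length Z →
  _≡_ {A = MarkedTree} (skeleton (proj₁ (assemble t₀ bs Z)) , marks (proj₁ (assemble t₀ bs Z))) (t₀ , bs)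
skeleton-assemble leaf      _  (false ∷ []) Z       _  = refl
skeleton-assemble leaf      _  (true ∷ [])  (_ ∷ Z) _  = refl
skeleton-assemble (add t u) mf bs           Z       enough with splitAt (val t) bs
... | b₁ , b₂ , refl = cong₂ (λ (t , bs) (u , cs) → add t u , bs Vec.++ cs) shape₁ shape₂
  where
  t′ = proj₁ (assemble t b₁ Z)
  Z₁ = proj₂ (assemble t b₁ Z)
  enough′ : count b₁ + count b₂ ≤ length Z
  enough′ = subst (_≤ length Z) (count-++ b₁ b₂) enough
  shape₁ = skeleton-assemble t (m+n≡0⇒m≡0 (mulCount t) mf) b₁ Z
    (≤-trans (m≤m+n (count b₁) (count b₂)) enough′)
  length-Z : length Z ≡ count b₁ + length Z₁
  length-Z = begin
    length Z                      ≡⟨ cong length (prims-assemble t b₁ Z) ⟨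
    length (prims t′ ++ Z₁)       ≡⟨ length-++ (prims t′) ⟩
    length (prims t′) + length Z₁ ≡⟨ cong (_+ length Z₁) (marks-count t′) ⟨
    count (marks t′) + length Z₁  ≡⟨ cong (λ w → count (proj₂ w) + length Z₁) shape₁ ⟩
    count b₁ + length Z₁          ∎
    where open ≡-Reasoning
  shape₂ = skeleton-assemble u (m+n≡0⇒n≡0 (mulCount t) mf) b₂ Z₁
    (+-cancelˡ-≤ (count b₁) (count b₂) (length Z₁) (subst (count b₁ + count b₂ ≤_) length-Z enough′))

++-prefix : ∀ (xs ys zs : List A) → xs ++ ys ≡ zs → length xs ≡ length zs → xs ≡ zs
++-prefix []       ys []       _ _ = refl
++-prefix (x ∷ xs) ys (z ∷ zs) e l =
  cong₂ _∷_ (proj₁ (∷-injective e)) (++-prefix xs ys zs (proj₂ (∷-injective e)) (suc-injective l))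

Skeleton : Set
Skeleton = Σ (List Block) λ Z → Σ Tree λ t₀ → mulCount t₀ ≡ 0 × Marks (val t₀) (length Z)

Skeleton-≡ : ∀ {Z Z′ t₀ t₀′ mf mf′ bs bs′ c c′} → Z ≡ Z′ → _≡_ {A = MarkedTree} (t₀ , bs) (t₀′ , bs′) →
  _≡_ {A = Skeleton} (Z , t₀ , mf , bs , c) (Z′ , t₀′ , mf′ , bs′ , c′)
Skeleton-≡ {Z} {t₀ = t₀} {bs = bs} refl refl =
  cong₂ (λ mf c → Z , t₀ , mf , bs , c) (≡-irrelevant _ _) (≡-irrelevant _ _)

skeleton-↔ : Tree ↔ Skeleton
skeleton-↔ = mk↔ₛ′ decompose reassemble decompose∘reassemble reassemble∘decompose
  where
  decompose : Tree → Skeleton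
  decompose t = prims t , skeleton t , skeleton-mulFree t , marks t , marks-count t
  reassemble : Skeleton → Tree
  reassemble (Z , t₀ , _ , bs , _) = proj₁ (assemble t₀ bs Z)
  reassemble∘decompose : ∀ t → reassemble (decompose t) ≡ t
  reassemble∘decompose t =
    cong proj₁ (trans (cong (assemble (skeleton t) (marks t)) (sym (++-identityʳ (prims t)))) (assemble-decompose t []))
  decompose∘reassemble : ∀ s → decompose (reassemble s) ≡ s
  decompose∘reassemble (Z , t₀ , mf , bs , c) =
    Skeleton-≡ (++-prefix (prims t) _ Z (prims-assemble t₀ bs Z) same-length) shape
    where
    t = reassemble (Z , t₀ , mf , bs , c)
    shape = skeleton-assemble t₀ mf bs Z (≤-reflexive c)
    same-length : length (prims t) ≡ length Z
    same-length = trans (sym (marks-count t)) (trans (cong (λ w → count (proj₂ w)) shape) c)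

Traced : Vec (ℕ × ℕ) p → ℕ → Skeleton → Set
Traced us n (Z , t₀ , _) = Fitting us Z × sumL Z + val t₀ ≡ n + length Z

traced-↔ : ∀ p (ℓ r : Vec ℕ p) n → FormulasTrace p ℓ r n ↔ Σ Skeleton (Traced (Vec.zip ℓ r) n)
traced-↔ p ℓ r n = Dependent.cong {k = bijection} skeleton-↔ (λ {t} → constraints t)
  where
  us = Vec.zip ℓ r
  value : ∀ t → (val t ≡ n) ↔ (sumL (prims t) + val (skeleton t) ≡ n + length (prims t))
  value t = prop-↔ ≡-irrelevant ≡-irrelevant
    (λ e → trans (+-comm _ (val (skeleton t))) (trans (sym (val-decompose t)) (cong₂ _+_ e (marks-count t))))
    (λ e → +-cancelʳ-≡ (count (marks t)) (val t) n (begin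
      val t + count (marks t)                   ≡⟨ val-decompose t ⟩
      val (skeleton t) + sumL (prims t)         ≡⟨ +-comm (val (skeleton t)) _ ⟩
      sumL (prims t) + val (skeleton t)         ≡⟨ e ⟩
      n + length (prims t)                      ≡⟨ cong (n +_) (marks-count t) ⟨
      n + count (marks t)                       ∎))
    where open ≡-Reasoning
  constraints : ∀ t → (Valid t × val t ≡ n × HasTrace t p ℓ r) ↔ Traced us n (Inverse.to skeleton-↔ t)
  constraints t = mk↔ₛ′
    (λ (v , e , h) → (Valid⇒blocks t v , trans (sym (trace-prims t)) h) , Inverse.to (value t) e)
    (λ ((vs , h) , e) → blocks⇒Valid t vs , Inverse.from (value t) e , trans (trace-prims t) h)
    (λ _ → cong₂ _,_ (Fitting-irrelevant us (prims t) _ _) (≡-irrelevant _ _))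
    (λ _ → cong₂ _,_ (Valid-irrelevant t _ _) (cong₂ _,_ (≡-irrelevant _ _) (traces-≡-irrelevant _ _)))

-- Marked multiplication-free trees t₀ with j marks and s + val t₀ = N: the
-- skeletons that complete products of total value s to a formula.
MarkedBases : ℕ → ℕ → ℕ → Set
MarkedBases s N j = Σ Tree λ t₀ → mulCount t₀ ≡ 0 × Marks (val t₀) j × s + val t₀ ≡ N

formulas-↔ : ∀ p (ℓ r : Vec ℕ p) n →
  FormulasTrace p ℓ r n ↔ Σ (List Block) (λ X → Fitting (Vec.zip ℓ r) X × MarkedBases (sumL X) (n + p) p)
formulas-↔ p ℓ r n = traced-↔ p ℓ r n ⨾ regroup ⨾ Σ-cong (λ X → Σ-cong (λ fit → fix-length X fit))
  where
  us = Vec.zip ℓ r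
  regroup : Σ Skeleton (Traced us n) ↔
            Σ (List Block) (λ X → Fitting us X × MarkedBases (sumL X) (n + length X) (length X))
  regroup = mk↔ₛ′ (λ ((X , t₀ , mf , mk) , fit , e) → X , fit , t₀ , mf , mk , e)
                  (λ (X , fit , t₀ , mf , mk , e) → (X , t₀ , mf , mk) , fit , e)
                  (λ _ → refl) (λ _ → refl)
  fix-length : ∀ X → Fitting us X → MarkedBases (sumL X) (n + length X) (length X) ↔ MarkedBases (sumL X) (n + p) p
  fix-length X fit = subst-↔ (λ j → MarkedBases (sumL X) (n + j) j) (Fitting-length us X fit)

-- The value m of the skeleton is determined by the skeleton itself.
eliminate-value : ∀ s N j → Σ ℕ (λ m → s + m ≡ N × (Marks m j × Formulas 0 m)) ↔ MarkedBases s N j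
eliminate-value s N j = mk↔ₛ′
  (λ { (.(val t₀) , e , mk , (t₀ , _ , refl , mf)) → t₀ , mf , mk , e })
  (λ (t₀ , mf , mk , e) → val t₀ , e , mk , (t₀ , mulFree⇒Valid t₀ mf , refl , mf))
  (λ _ → refl)
  (λ { (.(val t₀) , e , mk , (t₀ , _ , refl , mf)) → cong (λ f → val t₀ , e , mk , f) (Formulas-≡ refl) })

Tuple-positive : ∀ (us : Vec (ℕ × ℕ) p) v → Tuple Products us v → VecAll.All (1 ≤_) v
Tuple-positive []       []      tt = []
Tuple-positive (u ∷ us) (x ∷ v) (((a , b) , _ , e) , πs) =
  subst (1 ≤_) e (*-mono-≤ (val-positive a) (val-positive b)) ∷ Tuple-positive us v πs

-- The summand of rhs in Defs, written with projections instead of a pattern lambda.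
rhsSummand : (F : ℕ → ℕ → ℕ) (p : ℕ) (ℓ r : Vec ℕ p) → Vec ℕ p → ℕ → ℕ
rhsSummand F p ℓ r v m =
  (m C p) * F 0 m * prodV (zipWith (λ u x → conv' (F (proj₁ u)) (F (proj₂ u)) x) (Vec.zip ℓ r) v)

rhs-↔ : (F : ℕ → ℕ → ℕ) → Counts F → ∀ p (ℓ r : Vec ℕ p) n → 1 ≤ p →
  Fin (rhs F p ℓ r n) ↔ Σ (List Block) (λ X → Fitting (Vec.zip ℓ r) X × MarkedBases (sumL X) (n + p) p)
rhs-↔ F counts p ℓ r n 1≤p =
  compositions-↔ p N G positive ⨾
  Σ-cong (λ v → Σ-cong (λ m → ↔-refl ×-↔ summand-↔ v m)) ⨾
  regroup ⨾
  tuples-to-list (λ s → Σ ℕ λ m → s + m ≡ N × (Marks m p × Formulas 0 m)) us ⨾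
  Σ-cong (λ X → ↔-refl ×-↔ eliminate-value (sumL X) N p)
  where
  N  = n + p
  G  = rhsSummand F p ℓ r
  us = Vec.zip ℓ r
  summand-↔ : ∀ v m → Fin (G v m) ↔ ((Marks m p × Formulas 0 m) × Tuple Products us v)
  summand-↔ v m = *↔× ⨾ ((*↔× ⨾ (binomial-↔ m p ×-↔ ↔-sym (counts 0 m))) ×-↔
    prodV-↔ _ Products (λ u x → conv'-↔ F counts (proj₁ u) (proj₂ u) x) us v)
  positive : PositiveSupport G
  positive v m y with Inverse.to (summand-↔ v m) y
  ... | ((bs , c) , _) , πs = Tuple-positive us v πs , ≤-trans 1≤p (subst (_≤ m) c (count≤length bs))
  regroup : Σ (Vec ℕ p) (λ v → Σ ℕ λ m → sumV v + m ≡ N × ((Marks m p × Formulas 0 m) × Tuple Products us v)) ↔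
            Σ (Vec ℕ p) (λ v → Tuple Products us v × Σ ℕ λ m → sumV v + m ≡ N × (Marks m p × Formulas 0 m))
  regroup = Σ-cong λ v → mk↔ₛ′ (λ (m , e , w , πs) → πs , m , e , w) (λ (πs , m , e , w) → m , e , w , πs)
                               (λ _ → refl) (λ _ → refl)

-- Lemma 4.4.
lemma4p4 : (F : ℕ → ℕ → ℕ)
    → (∀ k n → Formulas k n ↔ Fin (F k n))
    → (k p : ℕ) (ℓ r : Vec ℕ p)
    → 1 ≤ k → 1 ≤ p → sumV (zipWith _+_ ℓ r) + p ≡ k
    → (n : ℕ) → 1 ≤ n
    → FormulasTrace p ℓ r n ↔ Fin (rhs F p ℓ r n)
lemma4p4 F counts k p ℓ r _ 1≤p _ n _ = formulas-↔ p ℓ r n ⨾ ↔-sym (rhs-↔ F counts p ℓ r n 1≤p)
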